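{- Let $l, m, n, k$ be positive integers with $l \leq m < n$. Let $\varepsilon([l,m],n)$ denote the number of nonempty subsets $X \subseteq [1,n]$ with $X \cap [l,m] = \emptyset$ and $\gcd(X\cup\{n\}) = 1$, and $\varepsilon_k([l,m],n)$ the number of subsets $X \subseteq [1,n]$ with $\#X = k$, $X\cap[l,m] = \emptyset$ and $\gcd(X\cup\{n\})=1$. Then (a) $\displaystyle \varepsilon([l,m],n) = \sum_{d\mid n}\mu(d)\, 2^{\lfloor (l-1)/d\rfloor + n/d - \lfloor m/d\rfloor}$; (b) $\displaystyle \varepsilon_k([l,m],n) = \sum_{d\mid n}\mu(d) \binom{\lfloor (l-1)/d\rfloor + n/d - \lfloor m/d\rfloor}{k}$.
   Context: For integers $a \leq b$, $[a,b] = \{a,\ldots,b\}$. $\mu$ is the Möbius function, $\lfloor x\rfloor$ the floor function; sums run over positive divisors $d$ of $n$. -}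

module Defs where

open import Data.Bool using (Bool; true; false; _∧_)
open import Data.Nat using (ℕ; zero; suc; _+_; _*_; _∸_; _^_; _≤_; _<_; _≤ᵇ_)
open import Data.Nat.DivMod using (_/_)
open import Data.Nat.Divisibility using (_∣_; _∣?_)
open import Data.Nat.GCD using (gcd)
open import Data.Nat.Primality using (Prime; prime?)
open import Data.Nat.Combinatorics using (_C_)
open import Data.Integer as ℤ using (ℤ; +_; -_)
open import Data.Fin using (Fin; toℕ)
open import Data.Fin.Subset using (Subset; _∈_; _∩_; Nonempty; Empty; ∣_∣)
open import Data.Fin.Subset.Properties using (_∈?_; nonempty?)
open import Data.List using (List; []; _∷_; map; filter; length; foldr; upTo; allFin; _++_)
open import Data.Vec using (Vec; []; _∷_; tabulate)
open import Data.Product using (_×_)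
open import Relation.Nullary using (Dec; ¬?)
open import Relation.Nullary.Decidable using (_×-dec_; ⌊_⌋)
open import Relation.Binary.PropositionalEquality using (_≡_)
open import Data.Nat.Properties using (_≟_)

sumℤ : List ℤ → ℤ
sumℤ = foldr ℤ._+_ (+ 0)

-- Möbius function (as usual): μ(n) = 0 if d² ∣ n for some d ≥ 2,
-- otherwise (-1)^(number of distinct primes dividing n).  μ(0) := 0 (never used).
hasSquareFactor : ℕ → Bool
hasSquareFactor n = foldr (λ d b → ⌊ (suc (suc d) * suc (suc d)) ∣? n ⌋ Data.Bool.∨ b) false (upTo n)

numPrimeDivisors : ℕ → ℕ
numPrimeDivisors n = length (filter (λ p → prime? p ×-dec (p ∣? n)) (upTo (suc n)))

μ : ℕ → ℤ
μ zero = + 0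
μ (suc n) with hasSquareFactor (suc n)
... | true  = + 0
... | false = (- (+ 1)) ℤ.^ numPrimeDivisors (suc n)

sumDivisors : (n : ℕ) → ((d : ℕ) → ℤ) → ℤ
sumDivisors n f = sumℤ (map f (filter (λ d → d ∣? n) (map suc (upTo n))))

-- All subsets of [1,n] (element i : Fin n represents the integer toℕ i + 1).
allSubsets : (n : ℕ) → List (Subset n)
allSubsets zero = [] ∷ []
allSubsets (suc n) = map (false ∷_) (allSubsets n) ++ map (true ∷_) (allSubsets n)

val : {n : ℕ} → Fin n → ℕ
val i = suc (toℕ i)

gcdWithN : (n : ℕ) → Subset n → ℕ
gcdWithN n X = foldr gcd n (map val (filter (_∈? X) (allFin n)))

interval : (n l m : ℕ) → Subset n
interval n l m = tabulate (λ i → (l ≤ᵇ val i) ∧ (val i ≤ᵇ m))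

ε : (l m n : ℕ) → ℕ
ε l m n = length (filter
  (λ X → nonempty? X ×-dec (¬? (nonempty? (X ∩ interval n l m)) ×-dec (gcdWithN n X ≟ 1)))
  (allSubsets n))

εₖ : (k l m n : ℕ) → ℕ
εₖ k l m n = length (filter
  (λ X → (∣ X ∣ ≟ k) ×-dec (¬? (nonempty? (X ∩ interval n l m)) ×-dec (gcdWithN n X ≟ 1)))
  (allSubsets n))

expo : (l m n d' : ℕ) → ℕ
expo l m n d' = ((l ∸ 1) / suc d' + n / suc d') ∸ (m / suc d')

-- summands μ(d) 2^(...) and μ(d) C(..., k); d = 0 never occurs (d ranges over divisors ≥ 1)
summandA : (l m n : ℕ) → ℕ → ℤ
summandA l m n zero = + 0
summandA l m n (suc d') = μ (suc d') ℤ.* + (2 ^ expo l m n d')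

summandB : (k l m n : ℕ) → ℕ → ℤ
summandB k l m n zero = + 0
summandB k l m n (suc d') = μ (suc d') ℤ.* + (expo l m n d' C k)

{-# OPTIONS --safe #-}
-- Expand the coprimality condition by Möbius inversion,
-- [gcd(X ∪ {n}) = 1] = Σ_{d ∣ gcd(X ∪ {n})} μ(d), and exchange the two sums. For a fixed
-- divisor d of n the sets X that avoid [l,m] and have d ∣ gcd(X ∪ {n}) are exactly the
-- subsets of the multiples of d outside [l,m]; there are ⌊(l-1)/d⌋ + n/d - ⌊m/d⌋ of
-- those, giving the factor 2^(…) in (a) and C(…, k) in (b). In (a) the condition X ≠ ∅
-- is automatic, since gcd(∅ ∪ {n}) = n > 1.
module Submission where

open import Data.Bool using (Bool; true; false; _∧_; _∨_; not; if_then_else_)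
open import Data.Bool.Properties using (∧-zeroʳ; ∨-zeroʳ; ⇔→≡)
open import Data.Fin using (Fin; toℕ)
open import Data.Fin.Subset as Subset using (Subset; _∈_; _∉_; _⊆_; _∩_; Nonempty; Empty)
open import Data.Fin.Subset.Properties using (_⊆?_; _∈?_; nonempty?; x∈p∩q⁺; x∈p∩q⁻)
open import Data.Integer as ℤ using (ℤ; +_; -_; _+_; _*_)
import Data.Integer.Properties as ℤ
open import Algebra.Properties.CommutativeSemigroup ℤ.+-commutativeSemigroup using (interchange)
open import Algebra.Properties.CommutativeSemigroup ℤ.*-commutativeSemigroup using (x∙yz≈y∙xz)
open import Data.List using (List; []; _∷_; map; filter; length; foldr; upTo; applyUpTo; allFin; _++_)
open import Data.List.Membership.Propositional using () renaming (_∈_ to _∈ₗ_)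
open import Data.List.Membership.Propositional.Properties using (∈-upTo⁺; ∈-allFin; ∈-map∘filter⁺; ∈-map∘filter⁻)
open import Data.List.Relation.Unary.All as All using (All; []; _∷_)
open import Data.List.Relation.Unary.Any using (here; there)
open import Data.Nat as ℕ using (ℕ; zero; suc; _≤_; _<_; z≤n; s≤s; z<s; NonZero; _≟_; _/_; _%_; _∸_; _≤ᵇ_; _^_)
import Data.Nat.Properties as ℕ
open import Data.Nat.Combinatorics using (_C_; nCk+nC[k+1]≡[n+1]C[k+1])
open import Data.Nat.Coprimality using (Coprime; coprime-divisor)
open import Data.Nat.DivMod using (m≡m%n+[m/n]*n; m%n<n)
open import Data.Nat.Divisibility
open import Data.Nat.GCD using (gcd; gcd[m,n]∣m; gcd[m,n]∣n; gcd-greatest)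
open import Data.Nat.ListAction using (product)
open import Data.Nat.Primality
open import Data.Nat.Primality.Factorisation using (factorise)
open import Data.Product using (∃-syntax; _×_; _,_; proj₁; proj₂)
open import Data.Sum using (inj₁; inj₂; [_,_]′)
open import Data.Vec using ([]; _∷_; tabulate)
open import Data.Vec.Properties using ([]=⇒lookup; lookup⇒[]=; lookup∘tabulate)
open import Function using (_∘_)
open import Function.Bundles using (_⇔_; mk⇔; Equivalence)
open import Relation.Binary.PropositionalEquality
open import Relation.Nullary using (¬_; Dec; yes; no; contradiction)
open import Relation.Nullary.Decidable using (does; ⌊_⌋; _×-dec_; ¬?; dec-true; dec-false; does-⇔)
open import Relation.Unary using (Decidable)

open import Defs

-- Indicators and finite sums

𝟙 : Bool → ℤ
𝟙 true  = + 1
𝟙 false = + 0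

𝟙-∧ : ∀ a b → 𝟙 (a ∧ b) ≡ 𝟙 a * 𝟙 b
𝟙-∧ true  b = sym (ℤ.*-identityˡ (𝟙 b))
𝟙-∧ false b = refl

𝟙-∧-* : ∀ a b x → 𝟙 (a ∧ b) * x ≡ 𝟙 a * (𝟙 b * x)
𝟙-∧-* true  b x = sym (ℤ.*-identityˡ (𝟙 b * x))
𝟙-∧-* false b x = refl

𝟙-split : ∀ b x → x ≡ 𝟙 b * x + 𝟙 (not b) * x
𝟙-split true  x = sym (trans (ℤ.+-identityʳ _) (ℤ.*-identityˡ x))
𝟙-split false x = sym (trans (ℤ.+-identityˡ _) (ℤ.*-identityˡ x))

𝟙-regroup : ∀ k e D c a x → e ∧ D ≡ c ∧ a → 𝟙 k * (𝟙 e * (𝟙 D * x)) ≡ 𝟙 c * (x * 𝟙 (k ∧ a))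
𝟙-regroup k e D c a x e∧D≡c∧a = begin
  𝟙 k * (𝟙 e * (𝟙 D * x))     ≡⟨ cong (𝟙 k *_) (𝟙-∧-* e D x) ⟨
  𝟙 k * (𝟙 (e ∧ D) * x)       ≡⟨ cong (λ b → 𝟙 k * (𝟙 b * x)) e∧D≡c∧a ⟩
  𝟙 k * (𝟙 (c ∧ a) * x)       ≡⟨ cong (𝟙 k *_) (𝟙-∧-* c a x) ⟩
  𝟙 k * (𝟙 c * (𝟙 a * x))     ≡⟨ x∙yz≈y∙xz (𝟙 k) (𝟙 c) (𝟙 a * x) ⟩
  𝟙 c * (𝟙 k * (𝟙 a * x))     ≡⟨ cong (𝟙 c *_) (𝟙-∧-* k a x) ⟨
  𝟙 c * (𝟙 (k ∧ a) * x)       ≡⟨ cong (𝟙 c *_) (ℤ.*-comm (𝟙 (k ∧ a)) x) ⟩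
  𝟙 c * (x * 𝟙 (k ∧ a))       ∎
  where open ≡-Reasoning

∑ : {A : Set} → List A → (A → ℤ) → ℤ
∑ xs f = sumℤ (map f xs)
infix 5 ∑
syntax ∑ xs (λ x → e) = ∑[ x ∈ xs ] e

module _ {A : Set} where

  ∑-zero : ∀ (xs : List A) → ∑[ x ∈ xs ] + 0 ≡ + 0
  ∑-zero []       = refl
  ∑-zero (x ∷ xs) = trans (ℤ.+-identityˡ _) (∑-zero xs)

  ∑-cong : ∀ xs {f g : A → ℤ} → (∀ x → f x ≡ g x) → ∑ xs f ≡ ∑ xs g
  ∑-cong []       f≗g = refl
  ∑-cong (x ∷ xs) f≗g = cong₂ _+_ (f≗g x) (∑-cong xs f≗g)

  ∑-++ : ∀ xs ys (f : A → ℤ) → ∑ (xs ++ ys) f ≡ ∑ xs f + ∑ ys f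
  ∑-++ []       ys f = sym (ℤ.+-identityˡ (∑ ys f))
  ∑-++ (x ∷ xs) ys f = trans (cong (_+_ (f x)) (∑-++ xs ys f)) (sym (ℤ.+-assoc (f x) _ _))

  ∑-map : ∀ {B : Set} (g : B → A) xs (f : A → ℤ) → ∑ (map g xs) f ≡ ∑ xs (f ∘ g)
  ∑-map g []       f = refl
  ∑-map g (x ∷ xs) f = cong (_+_ (f (g x))) (∑-map g xs f)

  ∑-*ˡ : ∀ xs c (f : A → ℤ) → ∑[ x ∈ xs ] (c * f x) ≡ c * ∑ xs f
  ∑-*ˡ []       c f = sym (ℤ.*-zeroʳ c)
  ∑-*ˡ (x ∷ xs) c f = trans (cong (_+_ (c * f x)) (∑-*ˡ xs c f)) (sym (ℤ.*-distribˡ-+ c (f x) _))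

  ∑-filter : ∀ {P : A → Set} (P? : Decidable P) xs (f : A → ℤ) →
             ∑ (filter P? xs) f ≡ ∑[ x ∈ xs ] (𝟙 (does (P? x)) * f x)
  ∑-filter P? []       f = refl
  ∑-filter P? (x ∷ xs) f with does (P? x)
  ... | true  = cong₂ _+_ (sym (ℤ.*-identityˡ (f x))) (∑-filter P? xs f)
  ... | false = trans (∑-filter P? xs f) (sym (ℤ.+-identityˡ _))

  length-filter : ∀ {P : A → Set} (P? : Decidable P) xs →
                  + length (filter P? xs) ≡ ∑[ x ∈ xs ] 𝟙 (does (P? x))
  length-filter P? []       = refl
  length-filter P? (x ∷ xs) with does (P? x)
  ... | true  = cong (_+_ (+ 1)) (length-filter P? xs)
  ... | false = trans (length-filter P? xs) (sym (ℤ.+-identityˡ _))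

∑< : ℕ → (ℕ → ℤ) → ℤ
∑< zero    f = + 0
∑< (suc n) f = ∑< n f + f n
infix 5 ∑<
syntax ∑< n (λ j → e) = ∑[ j < n ] e

∑<-cong : ∀ n {f g : ℕ → ℤ} → (∀ j → j < n → f j ≡ g j) → ∑< n f ≡ ∑< n g
∑<-cong zero    f≗g = refl
∑<-cong (suc n) f≗g = cong₂ _+_ (∑<-cong n (λ j j<n → f≗g j (ℕ.m<n⇒m<1+n j<n))) (f≗g n ℕ.≤-refl)

∑<-zero : ∀ n {f : ℕ → ℤ} → (∀ j → j < n → f j ≡ + 0) → ∑< n f ≡ + 0
∑<-zero zero    f≗0 = refl
∑<-zero (suc n) f≗0 = cong₂ _+_ (∑<-zero n (λ j j<n → f≗0 j (ℕ.m<n⇒m<1+n j<n))) (f≗0 n ℕ.≤-refl)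

∑<-one : ∀ n → ∑[ j < n ] + 1 ≡ + n
∑<-one zero    = refl
∑<-one (suc n) = trans (cong (_+ + 1) (∑<-one n)) (cong +_ (ℕ.+-comm n 1))

∑<-+ : ∀ n (f g : ℕ → ℤ) → ∑[ j < n ] (f j + g j) ≡ ∑< n f + ∑< n g
∑<-+ zero    f g = refl
∑<-+ (suc n) f g = trans (cong (_+ (f n + g n)) (∑<-+ n f g)) (interchange (∑< n f) (∑< n g) (f n) (g n))

∑<-*ˡ : ∀ n c (f : ℕ → ℤ) → ∑[ j < n ] (c * f j) ≡ c * ∑< n f
∑<-*ˡ zero    c f = sym (ℤ.*-zeroʳ c)
∑<-*ˡ (suc n) c f = trans (cong (_+ c * f n) (∑<-*ˡ n c f)) (sym (ℤ.*-distribˡ-+ c _ (f n)))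

∑<-split : ∀ a b (f : ℕ → ℤ) → ∑< (a ℕ.+ b) f ≡ ∑< a f + (∑[ j < b ] f (a ℕ.+ j))
∑<-split a zero    f = trans (cong (λ n → ∑< n f) (ℕ.+-identityʳ a)) (sym (ℤ.+-identityʳ _))
∑<-split a (suc b) f = begin
  ∑< (a ℕ.+ suc b) f                                   ≡⟨ cong (λ n → ∑< n f) (ℕ.+-suc a b) ⟩
  ∑< (a ℕ.+ b) f + f (a ℕ.+ b)                         ≡⟨ cong (_+ f (a ℕ.+ b)) (∑<-split a b f) ⟩
  ∑< a f + (∑[ j < b ] f (a ℕ.+ j)) + f (a ℕ.+ b)        ≡⟨ ℤ.+-assoc (∑< a f) _ _ ⟩
  ∑< a f + (∑[ j < suc b ] f (a ℕ.+ j))                  ∎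
  where open ≡-Reasoning

∑<-split-at : ∀ {a n} (f : ℕ → ℤ) → a ≤ n → ∑< n f ≡ ∑< a f + (∑[ j < n ∸ a ] f (a ℕ.+ j))
∑<-split-at {a} {n} f a≤n = trans (cong (λ k → ∑< k f) (sym (ℕ.m+[n∸m]≡n a≤n))) (∑<-split a (n ∸ a) f)

∑<-suc : ∀ n (f : ℕ → ℤ) → ∑< (suc n) f ≡ f 0 + (∑[ j < n ] f (suc j))
∑<-suc n f = trans (∑<-split 1 n f) (cong (_+ (∑[ j < n ] f (suc j))) (ℤ.+-identityˡ (f 0)))

∑<-truncate : ∀ {a c} (f : ℕ → ℤ) → a ≤ c → (∀ j → a ≤ j → f j ≡ + 0) → ∑< c f ≡ ∑< a f
∑<-truncate {a} {c} f a≤c f≗0 = begin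
  ∑< c f                                     ≡⟨ ∑<-split-at f a≤c ⟩
  ∑< a f + (∑[ j < c ∸ a ] f (a ℕ.+ j))      ≡⟨ cong (_+_ (∑< a f)) (∑<-zero (c ∸ a) (λ j _ → f≗0 (a ℕ.+ j) (ℕ.m≤m+n a j))) ⟩
  ∑< a f + + 0                               ≡⟨ ℤ.+-identityʳ _ ⟩
  ∑< a f                                     ∎
  where open ≡-Reasoning

∑-applyUpTo : ∀ {A : Set} (g : ℕ → A) n (f : A → ℤ) → ∑ (applyUpTo g n) f ≡ ∑< n (f ∘ g)
∑-applyUpTo g zero    f = refl
∑-applyUpTo g (suc n) f = trans (cong (_+_ (f (g 0))) (∑-applyUpTo (g ∘ suc) n f)) (sym (∑<-suc n (f ∘ g)))

∑-∑<-comm : ∀ {A : Set} (xs : List A) n (f : A → ℕ → ℤ) →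
            ∑[ x ∈ xs ] ∑< n (f x) ≡ ∑[ j < n ] ∑[ x ∈ xs ] f x j
∑-∑<-comm []       n f = sym (∑<-zero n (λ _ _ → refl))
∑-∑<-comm (x ∷ xs) n f = trans (cong (_+_ (∑< n (f x))) (∑-∑<-comm xs n f)) (sym (∑<-+ n (f x) _))

∤-between-multiples : ∀ d q {j} → suc j < d → ¬ d ∣ suc (d ℕ.* q ℕ.+ j)
∤-between-multiples d q {j} j+1<d d∣ = ℕ.<⇒≱ j+1<d (∣⇒≤ (∣m+n∣m⇒∣n d∣dq+[j+1] (m∣m*n q)))
  where
  d∣dq+[j+1] : d ∣ d ℕ.* q ℕ.+ suc j
  d∣dq+[j+1] = subst (d ∣_) (sym (ℕ.+-suc (d ℕ.* q) j)) d∣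

∑<-multiples : ∀ p .{{_ : NonZero p}} M (f : ℕ → ℤ) →
               ∑[ j < p ℕ.* M ] (𝟙 (does (p ∣? suc j)) * f (suc j)) ≡ ∑[ e < M ] f (p ℕ.* suc e)
∑<-multiples p zero f rewrite ℕ.*-zeroʳ p = refl
∑<-multiples p@(suc p′) (suc M) f = begin
  ∑< (p ℕ.* suc M) F                                  ≡⟨ cong (λ n → ∑< n F) pM+p ⟩
  ∑< (p ℕ.* M ℕ.+ p) F                                ≡⟨ ∑<-split (p ℕ.* M) p F ⟩
  ∑< (p ℕ.* M) F + (∑[ j < p ] F (p ℕ.* M ℕ.+ j))     ≡⟨ cong₂ _+_ (∑<-multiples p M f) last-block ⟩
  (∑[ e < M ] f (p ℕ.* suc e)) + f (p ℕ.* suc M)      ∎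
  where
  open ≡-Reasoning
  F : ℕ → ℤ
  F j = 𝟙 (does (p ∣? suc j)) * f (suc j)
  pM+p : p ℕ.* suc M ≡ p ℕ.* M ℕ.+ p
  pM+p = trans (ℕ.*-suc p M) (ℕ.+-comm p (p ℕ.* M))
  non-multiple : ∀ j → j < p′ → F (p ℕ.* M ℕ.+ j) ≡ + 0
  non-multiple j j<p′ = cong (λ b → 𝟙 b * f (suc (p ℕ.* M ℕ.+ j)))
                             (dec-false (p ∣? _) (∤-between-multiples p M (s≤s j<p′)))
  multiple : suc (p ℕ.* M ℕ.+ p′) ≡ p ℕ.* suc M
  multiple = trans (sym (ℕ.+-suc (p ℕ.* M) p′)) (sym pM+p)
  last-block : ∑[ j < p ] F (p ℕ.* M ℕ.+ j) ≡ f (p ℕ.* suc M)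
  last-block = begin
    (∑[ j < p′ ] F (p ℕ.* M ℕ.+ j)) + F (p ℕ.* M ℕ.+ p′)  ≡⟨ cong (_+ F (p ℕ.* M ℕ.+ p′)) (∑<-zero p′ non-multiple) ⟩
    + 0 + F (p ℕ.* M ℕ.+ p′)                             ≡⟨ ℤ.+-identityˡ _ ⟩
    F (p ℕ.* M ℕ.+ p′)                                   ≡⟨ cong (λ n → 𝟙 (does (p ∣? n)) * f n) multiple ⟩
    𝟙 (does (p ∣? p ℕ.* suc M)) * f (p ℕ.* suc M)
      ≡⟨ cong (λ b → 𝟙 b * f (p ℕ.* suc M)) (dec-true (p ∣? _) (m∣m*n (suc M))) ⟩
    + 1 * f (p ℕ.* suc M)                                ≡⟨ ℤ.*-identityˡ _ ⟩
    f (p ℕ.* suc M)                                      ∎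

∑<-divisible : ∀ d .{{_ : NonZero d}} x → ∑[ j < x ] 𝟙 (does (d ∣? suc j)) ≡ + (x / d)
∑<-divisible d x = begin
  ∑< x D                                         ≡⟨ cong (λ y → ∑< y D) x≡dq+r ⟩
  ∑< (d ℕ.* q ℕ.+ r) D                           ≡⟨ ∑<-split (d ℕ.* q) r D ⟩
  ∑< (d ℕ.* q) D + (∑[ j < r ] D (d ℕ.* q ℕ.+ j))  ≡⟨ cong₂ _+_ multiples remainder ⟩
  + q + + 0                                      ≡⟨ ℤ.+-identityʳ (+ q) ⟩
  + q                                            ∎
  where
  open ≡-Reasoning
  D : ℕ → ℤ
  D j = 𝟙 (does (d ∣? suc j))
  q r : ℕ
  q = x / d
  r = x % d
  x≡dq+r : x ≡ d ℕ.* q ℕ.+ r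
  x≡dq+r = trans (m≡m%n+[m/n]*n x d) (trans (ℕ.+-comm r (q ℕ.* d)) (cong (ℕ._+ r) (ℕ.*-comm q d)))
  multiples : ∑< (d ℕ.* q) D ≡ + q
  multiples = begin
    ∑< (d ℕ.* q) D                               ≡⟨ ∑<-cong (d ℕ.* q) (λ j _ → ℤ.*-identityʳ (D j)) ⟨
    ∑[ j < d ℕ.* q ] (D j * + 1)                 ≡⟨ ∑<-multiples d q (λ _ → + 1) ⟩
    ∑[ e < q ] + 1                               ≡⟨ ∑<-one q ⟩
    + q                                          ∎
  remainder : ∑[ j < r ] D (d ℕ.* q ℕ.+ j) ≡ + 0
  remainder = ∑<-zero r (λ j j<r →
    cong 𝟙 (dec-false (d ∣? _) (∤-between-multiples d q (ℕ.<-≤-trans (s≤s j<r) (m%n<n x d)))))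

-- The Möbius function

prime⇒1<p : ∀ {p} → Prime p → 1 < p
prime⇒1<p {p} pr = ℕ.nonTrivial⇒n>1 p {{prime⇒nonTrivial pr}}

prime⇒p*n≢0 : ∀ {p n} → Prime p → .{{NonZero n}} → NonZero (p ℕ.* n)
prime⇒p*n≢0 {p} {n} pr = ℕ.m*n≢0 p n {{prime⇒nonZero pr}}

∃-prime-divisor : ∀ g → 1 < g → ∃[ p ] Prime p × p ∣ g
∃-prime-divisor g@(suc _) 1<g with factorise g
... | record { factors = [] ; isFactorisation = g≡1 } = contradiction g≡1 (ℕ.>⇒≢ 1<g)
... | record { factors = p ∷ ps ; isFactorisation = g≡p*ps ; factorsPrime = pr ∷ _ } =
  p , pr , subst (p ∣_) (sym g≡p*ps) (m∣m*n (product ps))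

prime∤⇒coprime : ∀ {p d} → Prime p → ¬ p ∣ d → Coprime d p
prime∤⇒coprime pr p∤d (i∣d , i∣p) with prime⇒irreducible pr i∣p
... | inj₁ i≡1  = i≡1
... | inj₂ refl = contradiction i∣d p∤d

prime-*-∣ : ∀ {p d g} → Prime p → ¬ p ∣ d → p ∣ g → d ∣ g → p ℕ.* d ∣ g
prime-*-∣ {p} {d} {g} pr p∤d p∣g d∣g = subst (p ℕ.* d ∣_) (sym g≡pq) (*-monoʳ-∣ p d∣q)
  where
  g≡pq : g ≡ p ℕ.* quotient p∣g
  g≡pq = m∣n⇒n≡m*quotient p∣g
  d∣q : d ∣ quotient p∣g
  d∣q = coprime-divisor (prime∤⇒coprime pr p∤d) (subst (d ∣_) g≡pq d∣g)

private
  hasSquareFactorIn : ℕ → List ℕ → Bool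
  hasSquareFactorIn N = foldr (λ d b → ⌊ (suc (suc d) ℕ.* suc (suc d)) ∣? N ⌋ ∨ b) false

  hasSquareFactorIn-sound : ∀ N xs → hasSquareFactorIn N xs ≡ true → ∃[ d ] 1 < d × d ℕ.* d ∣ N
  hasSquareFactorIn-sound N (d ∷ xs) h with (suc (suc d) ℕ.* suc (suc d)) ∣? N
  ... | yes dd∣N = suc (suc d) , s≤s (s≤s z≤n) , dd∣N
  ... | no  _    = hasSquareFactorIn-sound N xs h

  hasSquareFactorIn-complete : ∀ N xs d → d ∈ₗ xs → (suc (suc d) ℕ.* suc (suc d)) ∣ N →
                               hasSquareFactorIn N xs ≡ true
  hasSquareFactorIn-complete N (x ∷ xs) d (here refl) dd∣N with (suc (suc d) ℕ.* suc (suc d)) ∣? N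
  ... | yes _    = refl
  ... | no  dd∤N = contradiction dd∣N dd∤N
  hasSquareFactorIn-complete N (x ∷ xs) d (there d∈xs) dd∣N =
    trans (cong (_ ∨_) (hasSquareFactorIn-complete N xs d d∈xs dd∣N)) (∨-zeroʳ _)

hasSquareFactor⇔ : ∀ N → .{{NonZero N}} → (hasSquareFactor N ≡ true) ⇔ (∃[ d ] 1 < d × d ℕ.* d ∣ N)
hasSquareFactor⇔ N = mk⇔ (hasSquareFactorIn-sound N (upTo N)) complete
  where
  complete : ∃[ d ] 1 < d × d ℕ.* d ∣ N → hasSquareFactor N ≡ true
  complete (1 , s≤s () , _)
  complete (suc (suc d) , _ , dd∣N) = hasSquareFactorIn-complete N (upTo N) d (∈-upTo⁺ d<N) dd∣N
    where
    d<N : d < N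
    d<N = ℕ.≤-trans (ℕ.n≤1+n (suc d)) (ℕ.≤-trans (ℕ.m≤m*n (suc (suc d)) (suc (suc d))) (∣⇒≤ dd∣N))

hasSquareFactor[p*e]≡hasSquareFactor[e] : ∀ {p e} → Prime p → ¬ p ∣ e → .{{NonZero e}} →
  hasSquareFactor (p ℕ.* e) ≡ hasSquareFactor e
hasSquareFactor[p*e]≡hasSquareFactor[e] {p} {e} pr p∤e = ⇔→≡ {z = true} (mk⇔
  (λ h → from (hasSquareFactor⇔ e) (strip (to (hasSquareFactor⇔ (p ℕ.* e) {{pe≢0}}) h)))
  (λ h → from (hasSquareFactor⇔ (p ℕ.* e) {{pe≢0}}) (extend (to (hasSquareFactor⇔ e) h))))
  where
  open Equivalence
  pe≢0 : NonZero (p ℕ.* e)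
  pe≢0 = prime⇒p*n≢0 pr
  strip : ∃[ d ] 1 < d × d ℕ.* d ∣ p ℕ.* e → ∃[ d ] 1 < d × d ℕ.* d ∣ e
  strip (d , 1<d , dd∣pe) = d , 1<d , coprime-divisor (prime∤⇒coprime pr p∤dd) dd∣pe
    where
    p∤d : ¬ p ∣ d
    p∤d p∣d = p∤e (*-cancelˡ-∣ p {{prime⇒nonZero pr}} (∣-trans (*-pres-∣ p∣d p∣d) dd∣pe))
    p∤dd : ¬ p ∣ d ℕ.* d
    p∤dd p∣dd = [ p∤d , p∤d ]′ (euclidsLemma d d pr p∣dd)
  extend : ∃[ d ] 1 < d × d ℕ.* d ∣ e → ∃[ d ] 1 < d × d ℕ.* d ∣ p ℕ.* e
  extend (d , 1<d , dd∣e) = d , 1<d , ∣n⇒∣m*n p dd∣e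

hasSquareFactor[p*e]≡true : ∀ {p e} → Prime p → p ∣ e → .{{NonZero e}} →
  hasSquareFactor (p ℕ.* e) ≡ true
hasSquareFactor[p*e]≡true {p} pr p∣e = Equivalence.from (hasSquareFactor⇔ _ {{prime⇒p*n≢0 pr}})
  (p , prime⇒1<p pr , *-pres-∣ (∣-refl {p}) p∣e)

isPrimeDivisor : ℕ → ℕ → ℤ
isPrimeDivisor N q = 𝟙 (does (prime? q) ∧ does (q ∣? N))

numPrimeDivisors≡∑ : ∀ N → + numPrimeDivisors N ≡ ∑[ q < suc N ] isPrimeDivisor N q
numPrimeDivisors≡∑ N = trans (length-filter (λ q → prime? q ×-dec (q ∣? N)) (upTo (suc N)))
                             (∑-applyUpTo (λ q → q) (suc N) (isPrimeDivisor N))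

isPrimeDivisor[p*e]≡isPrimeDivisor[e]+δ : ∀ {p e} → Prime p → ¬ p ∣ e → ∀ q →
  isPrimeDivisor (p ℕ.* e) q ≡ isPrimeDivisor e q + 𝟙 (does (q ≟ p))
isPrimeDivisor[p*e]≡isPrimeDivisor[e]+δ {p} {e} pr p∤e q with q ≟ p
... | yes refl rewrite dec-true (prime? p) pr | dec-true (p ∣? p ℕ.* e) (m∣m*n e)
                     | dec-false (p ∣? e) p∤e | dec-true (p ≟ p) refl = refl
... | no q≢p   rewrite dec-false (q ≟ p) q≢p = trans (same-divisibility (prime? q)) (sym (ℤ.+-identityʳ _))
  where
  q∣pe⇒q∣e : Prime q → q ∣ p ℕ.* e → q ∣ e
  q∣pe⇒q∣e pq q∣pe with euclidsLemma p e pq q∣pe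
  ... | inj₂ q∣e = q∣e
  ... | inj₁ q∣p with prime⇒irreducible pr q∣p
  ...   | inj₁ refl = contradiction pq ¬prime[1]
  ...   | inj₂ q≡p  = contradiction q≡p q≢p
  same-divisibility : (q? : Dec (Prime q)) → 𝟙 (does q? ∧ does (q ∣? p ℕ.* e)) ≡ 𝟙 (does q? ∧ does (q ∣? e))
  same-divisibility (no _)   = refl
  same-divisibility (yes pq) = cong 𝟙 (does-⇔ (mk⇔ (q∣pe⇒q∣e pq) (∣n⇒∣m*n p)) (q ∣? p ℕ.* e) (q ∣? e))

∑<-𝟙≟ : ∀ {p} B → p < B → ∑[ q < B ] 𝟙 (does (q ≟ p)) ≡ + 1
∑<-𝟙≟ {p} (suc B) (s≤s p≤B) with ℕ.m≤n⇒m<n∨m≡n p≤B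
... | inj₁ p<B  rewrite dec-false (B ≟ p) (ℕ.>⇒≢ p<B) = trans (ℤ.+-identityʳ _) (∑<-𝟙≟ B p<B)
... | inj₂ refl rewrite dec-true (p ≟ p) refl =
  cong (_+ + 1) (∑<-zero p (λ q q<p → cong 𝟙 (dec-false (q ≟ p) (ℕ.<⇒≢ q<p))))

numPrimeDivisors[p*e]≡1+numPrimeDivisors[e] : ∀ {p e} → Prime p → ¬ p ∣ e → .{{NonZero e}} →
  numPrimeDivisors (p ℕ.* e) ≡ suc (numPrimeDivisors e)
numPrimeDivisors[p*e]≡1+numPrimeDivisors[e] {p} {e} pr p∤e = ℤ.+-injective (begin
  + numPrimeDivisors (p ℕ.* e)                               ≡⟨ numPrimeDivisors≡∑ (p ℕ.* e) ⟩
  ∑[ q < suc (p ℕ.* e) ] isPrimeDivisor (p ℕ.* e) q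
                                     ≡⟨ ∑<-cong (suc (p ℕ.* e)) (λ q _ → isPrimeDivisor[p*e]≡isPrimeDivisor[e]+δ pr p∤e q) ⟩
  ∑[ q < suc (p ℕ.* e) ] (isPrimeDivisor e q + 𝟙 (does (q ≟ p)))
                                                             ≡⟨ ∑<-+ (suc (p ℕ.* e)) (isPrimeDivisor e) _ ⟩
  (∑[ q < suc (p ℕ.* e) ] isPrimeDivisor e q) + (∑[ q < suc (p ℕ.* e) ] 𝟙 (does (q ≟ p)))
                                                             ≡⟨ cong₂ _+_ (∑<-truncate (isPrimeDivisor e) (s≤s e≤pe) beyond-e)
                                                                          (∑<-𝟙≟ (suc (p ℕ.* e)) (s≤s p≤pe)) ⟩
  (∑[ q < suc e ] isPrimeDivisor e q) + + 1                  ≡⟨ cong (_+ + 1) (numPrimeDivisors≡∑ e) ⟨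
  + (numPrimeDivisors e ℕ.+ 1)                               ≡⟨ cong +_ (ℕ.+-comm (numPrimeDivisors e) 1) ⟩
  + suc (numPrimeDivisors e)                                 ∎)
  where
  open ≡-Reasoning
  e≤pe : e ≤ p ℕ.* e
  e≤pe = ℕ.m≤n*m e p {{prime⇒nonZero pr}}
  p≤pe : p ≤ p ℕ.* e
  p≤pe = ℕ.m≤m*n p e
  beyond-e : ∀ q → suc e ≤ q → isPrimeDivisor e q ≡ + 0
  beyond-e q e<q rewrite dec-false (q ∣? e) (λ q∣e → ℕ.<⇒≱ e<q (∣⇒≤ q∣e)) = cong 𝟙 (∧-zeroʳ _)

μ-unfold : ∀ N → .{{NonZero N}} → μ N ≡ (if hasSquareFactor N then + 0 else (- (+ 1)) ℤ.^ numPrimeDivisors N)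
μ-unfold (suc n) with hasSquareFactor (suc n)
... | true  = refl
... | false = refl

μ[p*e]≡-μ[e] : ∀ {p e} → Prime p → ¬ p ∣ e → .{{NonZero e}} → μ (p ℕ.* e) ≡ - μ e
μ[p*e]≡-μ[e] {p} {e} pr p∤e {{e≢0}}
  rewrite μ-unfold (p ℕ.* e) {{prime⇒p*n≢0 pr}} | μ-unfold e {{e≢0}}
        | hasSquareFactor[p*e]≡hasSquareFactor[e] pr p∤e {{e≢0}}
        | numPrimeDivisors[p*e]≡1+numPrimeDivisors[e] pr p∤e {{e≢0}}
  with hasSquareFactor e
... | true  = refl
... | false = ℤ.-1*i≡-i _

μ[p*e]≡0 : ∀ {p e} → Prime p → p ∣ e → .{{NonZero e}} → μ (p ℕ.* e) ≡ + 0
μ[p*e]≡0 {p} {e} pr p∣e {{e≢0}}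
  rewrite μ-unfold (p ℕ.* e) {{prime⇒p*n≢0 pr}} | hasSquareFactor[p*e]≡true pr p∣e {{e≢0}} = refl

∑∣≤ : ℕ → ℕ → (ℕ → ℤ) → ℤ
∑∣≤ N g f = ∑[ j < N ] (𝟙 (does (suc j ∣? g)) * f (suc j))

∑∣≤-cong : ∀ N g {f h : ℕ → ℤ} → (∀ d′ → f (suc d′) ≡ h (suc d′)) → ∑∣≤ N g f ≡ ∑∣≤ N g h
∑∣≤-cong N g f≗h = ∑<-cong N (λ j _ → cong (𝟙 (does (suc j ∣? g)) *_) (f≗h j))

sumDivisors≡∑∣≤ : ∀ n (f : ℕ → ℤ) → sumDivisors n f ≡ ∑∣≤ n n f
sumDivisors≡∑∣≤ n f = begin
  sumDivisors n f                                            ≡⟨ ∑-filter (_∣? n) (map suc (upTo n)) f ⟩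
  ∑[ d ∈ map suc (upTo n) ] (𝟙 (does (d ∣? n)) * f d)        ≡⟨ ∑-map suc (upTo n) _ ⟩
  ∑[ j ∈ upTo n ] (𝟙 (does (suc j ∣? n)) * f (suc j))        ≡⟨ ∑-applyUpTo (λ j → j) n _ ⟩
  ∑∣≤ n n f                                                  ∎
  where open ≡-Reasoning

∑∣≤-truncate : ∀ {g N} .{{_ : NonZero g}} (f : ℕ → ℤ) → g ≤ N → ∑∣≤ N g f ≡ ∑∣≤ g g f
∑∣≤-truncate {g} f g≤N = ∑<-truncate _ g≤N beyond-g
  where
  beyond-g : ∀ j → g ≤ j → 𝟙 (does (suc j ∣? g)) * f (suc j) ≡ + 0
  beyond-g j g≤j rewrite dec-false (suc j ∣? g) (λ j+1∣g → ℕ.<⇒≱ (s≤s g≤j) (∣⇒≤ j+1∣g)) = refl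

-- Each divisor e with p ∤ e cancels against p·e, as μ(p·e) = -μ(e); the divisors p·e with
-- p ∣ e contribute μ(p·e) = 0.
μ-divisor-pair-cancels : ∀ {g p} → Prime p → p ∣ g → ∀ e → (p∣? : Dec (p ∣ suc e)) →
  𝟙 (does (p ℕ.* suc e ∣? g)) * μ (p ℕ.* suc e) + 𝟙 (not (does p∣?)) * (𝟙 (does (suc e ∣? g)) * μ (suc e)) ≡ + 0
μ-divisor-pair-cancels {g} {p} pr p∣g e (yes p∣e+1) = begin
  𝟙 (does (p ℕ.* suc e ∣? g)) * μ (p ℕ.* suc e) + + 0  ≡⟨ ℤ.+-identityʳ _ ⟩
  𝟙 (does (p ℕ.* suc e ∣? g)) * μ (p ℕ.* suc e)        ≡⟨ cong (𝟙 (does (p ℕ.* suc e ∣? g)) *_) (μ[p*e]≡0 pr p∣e+1) ⟩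
  𝟙 (does (p ℕ.* suc e ∣? g)) * + 0                    ≡⟨ ℤ.*-zeroʳ (𝟙 (does (p ℕ.* suc e ∣? g))) ⟩
  + 0                                                  ∎
  where open ≡-Reasoning
μ-divisor-pair-cancels {g} {p} pr p∣g e (no p∤e+1) = begin
  𝟙 (does (p ℕ.* suc e ∣? g)) * μ (p ℕ.* suc e) + + 1 * h
    ≡⟨ cong₂ _+_ (cong₂ _*_ (cong 𝟙 (does-⇔ pe+1∣g⇔e+1∣g (p ℕ.* suc e ∣? g) (suc e ∣? g))) (μ[p*e]≡-μ[e] pr p∤e+1))
                 (ℤ.*-identityˡ h) ⟩
  𝟙 (does (suc e ∣? g)) * - μ (suc e) + h              ≡⟨ cong (_+ h) (ℤ.neg-distribʳ-* (𝟙 (does (suc e ∣? g))) (μ (suc e))) ⟨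
  - h + h                                              ≡⟨ ℤ.+-inverseˡ h ⟩
  + 0                                                  ∎
  where
  open ≡-Reasoning
  h : ℤ
  h = 𝟙 (does (suc e ∣? g)) * μ (suc e)
  pe+1∣g⇔e+1∣g : p ℕ.* suc e ∣ g ⇔ suc e ∣ g
  pe+1∣g⇔e+1∣g = mk⇔ (m*n∣⇒n∣ p (suc e)) (prime-*-∣ pr p∤e+1 p∣g)

∑∣≤-μ-vanishes : ∀ {g p} .{{_ : NonZero g}} → Prime p → p ∣ g → ∑∣≤ g g μ ≡ + 0
∑∣≤-μ-vanishes {g} {p} pr p∣g = begin
  ∑[ j < g ] h (suc j)                                       ≡⟨ ∑∣≤-truncate μ g≤pg ⟨
  ∑[ j < p ℕ.* g ] h (suc j)                                 ≡⟨ ∑<-cong (p ℕ.* g) (λ j _ → 𝟙-split (p∣ j) (h (suc j))) ⟩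
  ∑[ j < p ℕ.* g ] (𝟙 (p∣ j) * h (suc j) + 𝟙 (not (p∣ j)) * h (suc j))
                                                             ≡⟨ ∑<-+ (p ℕ.* g) _ _ ⟩
  (∑[ j < p ℕ.* g ] (𝟙 (p∣ j) * h (suc j))) + (∑[ j < p ℕ.* g ] (𝟙 (not (p∣ j)) * h (suc j)))
                                                             ≡⟨ cong₂ _+_ (∑<-multiples p g h) (∑<-truncate _ g≤pg beyond-g) ⟩
  (∑[ e < g ] h (p ℕ.* suc e)) + (∑[ e < g ] (𝟙 (not (p∣ e)) * h (suc e)))
                                                             ≡⟨ ∑<-+ g _ _ ⟨
  ∑[ e < g ] (h (p ℕ.* suc e) + 𝟙 (not (p∣ e)) * h (suc e))  ≡⟨ ∑<-zero g (λ e _ → cancel e) ⟩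
  + 0                                                        ∎
  where
  open ≡-Reasoning
  instance
    p≢0 : NonZero p
    p≢0 = prime⇒nonZero pr
  h : ℕ → ℤ
  h d = 𝟙 (does (d ∣? g)) * μ d
  p∣ : ℕ → Bool
  p∣ j = does (p ∣? suc j)
  g≤pg : g ≤ p ℕ.* g
  g≤pg = ℕ.m≤n*m g p
  beyond-g : ∀ j → g ≤ j → 𝟙 (not (p∣ j)) * h (suc j) ≡ + 0
  beyond-g j g≤j rewrite dec-false (suc j ∣? g) (λ j+1∣g → ℕ.<⇒≱ (s≤s g≤j) (∣⇒≤ j+1∣g)) =
    ℤ.*-zeroʳ (𝟙 (not (p∣ j)))
  cancel : ∀ e → h (p ℕ.* suc e) + 𝟙 (not (p∣ e)) * h (suc e) ≡ + 0
  cancel e = μ-divisor-pair-cancels pr p∣g e (p ∣? suc e)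

∑∣≤-μ : ∀ g .{{_ : NonZero g}} → ∑∣≤ g g μ ≡ 𝟙 (does (g ≟ 1))
∑∣≤-μ 1 = refl
∑∣≤-μ g@(suc (suc _)) with ∃-prime-divisor g (s≤s (s≤s z≤n))
... | p , pr , p∣g = ∑∣≤-μ-vanishes pr p∣g

-- Counting subsets

∑-allSubsets-suc : ∀ n (F : Subset (suc n) → ℤ) →
                   ∑ (allSubsets (suc n)) F
                     ≡ (∑[ X ∈ allSubsets n ] F (false ∷ X)) + (∑[ X ∈ allSubsets n ] F (true ∷ X))
∑-allSubsets-suc n F = trans (∑-++ (map (false ∷_) (allSubsets n)) _ F)
                             (cong₂ _+_ (∑-map (false ∷_) (allSubsets n) F) (∑-map (true ∷_) (allSubsets n) F))

#subsets-⊆ : ∀ {n} (A : Subset n) → ∑[ X ∈ allSubsets n ] 𝟙 (does (X ⊆? A)) ≡ + (2 ^ Subset.∣ A ∣)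
#subsets-⊆ []          = refl
#subsets-⊆ {suc n} (false ∷ A) = begin
  ∑[ X ∈ allSubsets (suc n) ] 𝟙 (does (X ⊆? false ∷ A))                  ≡⟨ ∑-allSubsets-suc n _ ⟩
  (∑[ X ∈ allSubsets n ] 𝟙 (does (X ⊆? A))) + (∑[ X ∈ allSubsets n ] + 0)  ≡⟨ cong₂ _+_ (#subsets-⊆ A) (∑-zero (allSubsets n)) ⟩
  + (2 ^ Subset.∣ A ∣) + + 0                                              ≡⟨ ℤ.+-identityʳ _ ⟩
  + (2 ^ Subset.∣ A ∣)                                                    ∎
  where open ≡-Reasoning
#subsets-⊆ {suc n} (true ∷ A) = begin
  ∑[ X ∈ allSubsets (suc n) ] 𝟙 (does (X ⊆? true ∷ A))                   ≡⟨ ∑-allSubsets-suc n _ ⟩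
  (∑[ X ∈ allSubsets n ] 𝟙 (does (X ⊆? A))) + (∑[ X ∈ allSubsets n ] 𝟙 (does (X ⊆? A)))
                                                                          ≡⟨ cong₂ _+_ (#subsets-⊆ A) (#subsets-⊆ A) ⟩
  + (2 ^ Subset.∣ A ∣ ℕ.+ 2 ^ Subset.∣ A ∣)                               ≡⟨ cong (λ k → + (2 ^ Subset.∣ A ∣ ℕ.+ k)) (ℕ.+-identityʳ _) ⟨
  + (2 ^ suc Subset.∣ A ∣)                                                ∎
  where open ≡-Reasoning

#subsets-⊆-of-size : ∀ {n} (A : Subset n) k →
  ∑[ X ∈ allSubsets n ] 𝟙 (does (Subset.∣ X ∣ ≟ k) ∧ does (X ⊆? A)) ≡ + (Subset.∣ A ∣ C k)
#subsets-⊆-of-size []          zero    = refl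
#subsets-⊆-of-size []          (suc k) = refl
#subsets-⊆-of-size {suc n} (false ∷ A) k = begin
  ∑[ X ∈ allSubsets (suc n) ] 𝟙 (does (Subset.∣ X ∣ ≟ k) ∧ does (X ⊆? false ∷ A))
                                                          ≡⟨ ∑-allSubsets-suc n _ ⟩
  (∑[ X ∈ allSubsets n ] 𝟙 (does (Subset.∣ X ∣ ≟ k) ∧ does (X ⊆? A)))
    + (∑[ X ∈ allSubsets n ] 𝟙 (does (suc Subset.∣ X ∣ ≟ k) ∧ false))
                                                          ≡⟨ cong₂ _+_ (#subsets-⊆-of-size A k) none ⟩
  + (Subset.∣ A ∣ C k) + + 0                              ≡⟨ ℤ.+-identityʳ _ ⟩
  + (Subset.∣ A ∣ C k)                                    ∎
  where
  open ≡-Reasoning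
  none : ∑[ X ∈ allSubsets n ] 𝟙 (does (suc Subset.∣ X ∣ ≟ k) ∧ false) ≡ + 0
  none = trans (∑-cong (allSubsets n) (λ X → cong 𝟙 (∧-zeroʳ _))) (∑-zero (allSubsets n))
#subsets-⊆-of-size {suc n} (true ∷ A) zero = begin
  ∑[ X ∈ allSubsets (suc n) ] 𝟙 (does (Subset.∣ X ∣ ≟ 0) ∧ does (X ⊆? true ∷ A))
                                                          ≡⟨ ∑-allSubsets-suc n _ ⟩
  (∑[ X ∈ allSubsets n ] 𝟙 (does (Subset.∣ X ∣ ≟ 0) ∧ does (X ⊆? A))) + (∑[ X ∈ allSubsets n ] + 0)
                                                          ≡⟨ cong₂ _+_ (#subsets-⊆-of-size A 0) (∑-zero (allSubsets n)) ⟩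
  + (Subset.∣ A ∣ C 0) + + 0                              ≡⟨ ℤ.+-identityʳ _ ⟩
  + (Subset.∣ A ∣ C 0)                                    ∎
  where open ≡-Reasoning
#subsets-⊆-of-size {suc n} (true ∷ A) (suc k) = begin
  ∑[ X ∈ allSubsets (suc n) ] 𝟙 (does (Subset.∣ X ∣ ≟ suc k) ∧ does (X ⊆? true ∷ A))
                                                          ≡⟨ ∑-allSubsets-suc n _ ⟩
  (∑[ X ∈ allSubsets n ] 𝟙 (does (Subset.∣ X ∣ ≟ suc k) ∧ does (X ⊆? A)))
    + (∑[ X ∈ allSubsets n ] 𝟙 (does (Subset.∣ X ∣ ≟ k) ∧ does (X ⊆? A)))
                                                          ≡⟨ cong₂ _+_ (#subsets-⊆-of-size A (suc k)) (#subsets-⊆-of-size A k) ⟩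
  + (Subset.∣ A ∣ C suc k ℕ.+ Subset.∣ A ∣ C k)           ≡⟨ cong +_ (ℕ.+-comm (Subset.∣ A ∣ C suc k) _) ⟩
  + (Subset.∣ A ∣ C k ℕ.+ Subset.∣ A ∣ C suc k)           ≡⟨ cong +_ (nCk+nC[k+1]≡[n+1]C[k+1] Subset.∣ A ∣ k) ⟩
  + (suc Subset.∣ A ∣ C suc k)                            ∎
  where open ≡-Reasoning

∈-tabulate⇔ : ∀ {n} (f : Fin n → Bool) i → i ∈ tabulate f ⇔ f i ≡ true
∈-tabulate⇔ f i = mk⇔ (λ i∈ → trans (sym (lookup∘tabulate f i)) ([]=⇒lookup i∈))
                      (λ fi → lookup⇒[]= i (tabulate f) (trans (lookup∘tabulate f i) fi))

∣tabulate∣≡∑ : ∀ n (h : ℕ → Bool) → + Subset.∣ tabulate {n = n} (λ i → h (toℕ i)) ∣ ≡ ∑[ j < n ] 𝟙 (h j)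
∣tabulate∣≡∑ zero    h = refl
∣tabulate∣≡∑ (suc n) h = trans (cons (h 0)) (sym (∑<-suc n (λ j → 𝟙 (h j))))
  where
  rest : + Subset.∣ tabulate {n = n} (λ i → h (suc (toℕ i))) ∣ ≡ ∑[ j < n ] 𝟙 (h (suc j))
  rest = ∣tabulate∣≡∑ n (λ j → h (suc j))
  cons : ∀ b → + Subset.∣ b ∷ tabulate {n = n} (λ i → h (suc (toℕ i))) ∣ ≡ 𝟙 b + (∑[ j < n ] 𝟙 (h (suc j)))
  cons true  = cong (_+_ (+ 1)) rest
  cons false = trans rest (sym (ℤ.+-identityˡ _))

inIntervalᵇ : ℕ → ℕ → ℕ → Bool
inIntervalᵇ l m v = (l ≤ᵇ v) ∧ (v ≤ᵇ m)

admissibleᵇ : ℕ → ℕ → ℕ → ℕ → Bool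
admissibleᵇ l m d v = not (inIntervalᵇ l m v) ∧ does (d ∣? v)

admissibleᵇ-left : ∀ l m d v → ¬ l ≤ v → admissibleᵇ l m d v ≡ does (d ∣? v)
admissibleᵇ-left l m d v l≰v = cong (λ b → not (b ∧ (v ≤ᵇ m)) ∧ does (d ∣? v)) (dec-false (l ℕ.≤? v) l≰v)

admissibleᵇ-inside : ∀ l m d v → l ≤ v → v ≤ m → admissibleᵇ l m d v ≡ false
admissibleᵇ-inside l m d v l≤v v≤m =
  cong₂ (λ b c → not (b ∧ c) ∧ does (d ∣? v)) (dec-true (l ℕ.≤? v) l≤v) (dec-true (v ℕ.≤? m) v≤m)

admissibleᵇ-right : ∀ l m d v → ¬ v ≤ m → admissibleᵇ l m d v ≡ does (d ∣? v)
admissibleᵇ-right l m d v v≰m =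
  cong (λ b → not b ∧ does (d ∣? v)) (trans (cong ((l ≤ᵇ v) ∧_) (dec-false (v ℕ.≤? m) v≰m)) (∧-zeroʳ _))

admissible : (n l m d : ℕ) → Subset n
admissible n l m d = tabulate (λ i → admissibleᵇ l m d (val i))

-- Splitting [1,n] at l-1 and m, the admissible elements are the multiples of d in
-- [1, l-1] and in [m+1, n].
∣admissible∣≡expo : ∀ {l m n} d′ → l ≤ m → m ≤ n → Subset.∣ admissible n l m (suc d′) ∣ ≡ expo l m n d′
∣admissible∣≡expo {l} {m} {n} d′ l≤m m≤n = begin
  count                          ≡⟨ ℕ.m+n∸n≡m count (m / d) ⟨
  (count ℕ.+ m / d) ∸ m / d      ≡⟨ cong (_∸ m / d) (ℤ.+-injective key) ⟩
  expo l m n d′                  ∎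
  where
  open ≡-Reasoning
  d L count : ℕ
  d = suc d′
  L = l ∸ 1
  count = Subset.∣ admissible n l m d ∣
  A D : ℕ → ℤ
  A j = 𝟙 (admissibleᵇ l m d (suc j))
  D j = 𝟙 (does (d ∣? suc j))
  W : ℤ
  W = ∑[ j < n ∸ m ] D (m ℕ.+ j)
  L≤m : L ≤ m
  L≤m = ℕ.≤-trans (ℕ.m∸n≤m l 1) l≤m
  below-l : ∀ j → j < L → A j ≡ D j
  below-l j j<L = cong 𝟙 (admissibleᵇ-left l m d (suc j) (λ l≤j+1 → ℕ.<⇒≱ j<L (ℕ.∸-monoˡ-≤ 1 l≤j+1)))
  inside : ∀ j → j < m ∸ L → A (L ℕ.+ j) ≡ + 0
  inside j j<m-L = cong 𝟙 (admissibleᵇ-inside l m d _ (ℕ.≤-trans (ℕ.m≤n+m∸n l 1) (s≤s (ℕ.m≤m+n L j)))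
                                               (subst (suc (L ℕ.+ j) ≤_) (ℕ.m+[n∸m]≡n L≤m) (ℕ.+-monoʳ-< L j<m-L)))
  above-m : ∀ j → A (m ℕ.+ j) ≡ D (m ℕ.+ j)
  above-m j = cong 𝟙 (admissibleᵇ-right l m d (suc (m ℕ.+ j)) (λ m+j<m → ℕ.<⇒≱ m+j<m (ℕ.m≤m+n m j)))
  ∑A : ∑< n A ≡ ∑< L D + + 0 + W
  ∑A = begin
    ∑< n A                                                         ≡⟨ ∑<-split-at A m≤n ⟩
    ∑< m A + (∑[ j < n ∸ m ] A (m ℕ.+ j))                          ≡⟨ cong₂ _+_ (∑<-split-at A L≤m) (∑<-cong (n ∸ m) (λ j _ → above-m j)) ⟩
    ∑< L A + (∑[ j < m ∸ L ] A (L ℕ.+ j)) + W                      ≡⟨ cong (_+ W) (cong₂ _+_ (∑<-cong L below-l) (∑<-zero (m ∸ L) inside)) ⟩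
    ∑< L D + + 0 + W                                               ∎
  key : + count + + (m / d) ≡ + (L / d ℕ.+ n / d)
  key = begin
    + count + + (m / d)                   ≡⟨ cong₂ _+_ (∣tabulate∣≡∑ n (admissibleᵇ l m d ∘ suc)) (sym (∑<-divisible d m)) ⟩
    ∑< n A + ∑< m D                       ≡⟨ cong (_+ ∑< m D) ∑A ⟩
    ∑< L D + + 0 + W + ∑< m D             ≡⟨ cong (λ x → x + W + ∑< m D) (ℤ.+-identityʳ (∑< L D)) ⟩
    ∑< L D + W + ∑< m D                   ≡⟨ ℤ.+-assoc (∑< L D) W (∑< m D) ⟩
    ∑< L D + (W + ∑< m D)                 ≡⟨ cong (_+_ (∑< L D)) (ℤ.+-comm W (∑< m D)) ⟩
    ∑< L D + (∑< m D + W)                 ≡⟨ cong (_+_ (∑< L D)) (∑<-split-at D m≤n) ⟨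
    ∑< L D + ∑< n D                       ≡⟨ cong₂ _+_ (∑<-divisible d L) (∑<-divisible d n) ⟩
    + (L / d) + + (n / d)                 ∎

does≡true⇔ : ∀ {P : Set} (P? : Dec P) → does P? ≡ true ⇔ P
does≡true⇔ (yes p) = mk⇔ (λ _ → p) (λ _ → refl)
does≡true⇔ (no ¬p) = mk⇔ (λ ()) (λ p → contradiction p ¬p)

not∧≡true⇔ : ∀ b c → not b ∧ c ≡ true ⇔ (¬ b ≡ true × c ≡ true)
not∧≡true⇔ true  c    = mk⇔ (λ ()) (λ (b≢true , _) → contradiction refl b≢true)
not∧≡true⇔ false true = mk⇔ (λ _ → (λ ()) , refl) (λ _ → refl)
not∧≡true⇔ false false = mk⇔ (λ ()) (λ { (_ , ()) })

∈-admissible⇔ : ∀ {n} l m d i → i ∈ admissible n l m d ⇔ (i ∉ interval n l m × d ∣ val i)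
∈-admissible⇔ l m d i = mk⇔
  (λ i∈A → let ¬i∈I , d∣i = to (not∧≡true⇔ _ _) (to (∈-tabulate⇔ _ i) i∈A)
           in ¬i∈I ∘ to (∈-tabulate⇔ _ i) , to (does≡true⇔ (d ∣? val i)) d∣i)
  (λ (i∉I , d∣i) → from (∈-tabulate⇔ _ i) (from (not∧≡true⇔ _ _)
                     (i∉I ∘ from (∈-tabulate⇔ _ i) , from (does≡true⇔ (d ∣? val i)) d∣i)))
  where open Equivalence

∣foldr-gcd⇔ : ∀ {d} n vs → d ∣ foldr gcd n vs ⇔ (d ∣ n × All (d ∣_) vs)
∣foldr-gcd⇔ n []       = mk⇔ (_, []) proj₁
∣foldr-gcd⇔ n (v ∷ vs) = mk⇔
  (λ d∣ → let d∣n , d∣vs = to (∣foldr-gcd⇔ n vs) (∣-trans d∣ (gcd[m,n]∣n v _))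
          in d∣n , ∣-trans d∣ (gcd[m,n]∣m v _) ∷ d∣vs)
  (λ { (d∣n , d∣v ∷ d∣vs) → gcd-greatest d∣v (from (∣foldr-gcd⇔ n vs) (d∣n , d∣vs)) })
  where open Equivalence

∣gcdWithN⇔ : ∀ {d} n (X : Subset n) → d ∣ gcdWithN n X ⇔ (d ∣ n × (∀ {i} → i ∈ X → d ∣ val i))
∣gcdWithN⇔ {d} n X = mk⇔
  (λ d∣g → let d∣n , d∣vs = to (∣foldr-gcd⇔ n vs) d∣g
           in d∣n , λ {i} i∈X → All.lookup d∣vs (∈-map∘filter⁺ val (_∈? X) (i , ∈-allFin i , refl , i∈X)))
  (λ { (d∣n , d∣X) → from (∣foldr-gcd⇔ n vs) (d∣n , All.tabulate (λ v∈vs →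
         let _ , _ , v≡val , i∈X = ∈-map∘filter⁻ val (_∈? X) {xs = allFin n} v∈vs
         in subst (d ∣_) (sym v≡val) (d∣X i∈X))) })
  where
  open Equivalence
  vs : List ℕ
  vs = map val (filter (_∈? X) (allFin n))

gcdWithN∣n : ∀ n (X : Subset n) → gcdWithN n X ∣ n
gcdWithN∣n n X = proj₁ (Equivalence.to (∣gcdWithN⇔ n X) ∣-refl)

gcdWithN-empty : ∀ n (X : Subset n) → Empty X → gcdWithN n X ≡ n
gcdWithN-empty n X X≡∅ =
  ∣-antisym (gcdWithN∣n n X) (Equivalence.from (∣gcdWithN⇔ n X) (∣-refl , λ i∈X → contradiction (_ , i∈X) X≡∅))

gcdWithN≡1⇒nonempty : ∀ {n} → 1 < n → (X : Subset n) → gcdWithN n X ≡ 1 → Nonempty X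
gcdWithN≡1⇒nonempty {n} 1<n X g≡1 with nonempty? X
... | yes X≢∅ = X≢∅
... | no  X≡∅ = contradiction (trans (sym (gcdWithN-empty n X X≡∅)) g≡1) (ℕ.>⇒≢ 1<n)

avoids∧∣gcd⇔∣∧⊆admissible : ∀ {n} l m d (X : Subset n) →
  (Empty (X ∩ interval n l m) × d ∣ gcdWithN n X) ⇔ (d ∣ n × X ⊆ admissible n l m d)
avoids∧∣gcd⇔∣∧⊆admissible {n} l m d X = mk⇔
  (λ (X∩I≡∅ , d∣g) → let d∣n , d∣X = to (∣gcdWithN⇔ n X) d∣g in
     d∣n , λ {i} i∈X → from (∈-admissible⇔ l m d i) ((λ i∈I → X∩I≡∅ (i , x∈p∩q⁺ (i∈X , i∈I))) , d∣X i∈X))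
  (λ (d∣n , X⊆A) →
     (λ (i , i∈X∩I) → let i∈X , i∈I = x∈p∩q⁻ X I i∈X∩I in proj₁ (to (∈-admissible⇔ l m d i) (X⊆A i∈X)) i∈I) ,
     from (∣gcdWithN⇔ n X) (d∣n , λ i∈X → proj₂ (to (∈-admissible⇔ l m d _) (X⊆A i∈X))))
  where
  open Equivalence
  I : Subset n
  I = interval n l m

𝟙-gcd≡1 : ∀ n .{{_ : NonZero n}} (X : Subset n) → 𝟙 (does (gcdWithN n X ≟ 1)) ≡ ∑∣≤ n (gcdWithN n X) μ
𝟙-gcd≡1 n X = sym (trans (∑∣≤-truncate {{g≢0}} μ (∣⇒≤ (gcdWithN∣n n X))) (∑∣≤-μ g {{g≢0}}))
  where
  g : ℕ
  g = gcdWithN n X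
  g≢0 : NonZero g
  g≢0 = ℕ.≢-nonZero (λ g≡0 → ℕ.≢-nonZero⁻¹ n (0∣⇒≡0 (subst (_∣ n) g≡0 (gcdWithN∣n n X))))

-- Counting coprime subsets

avoidsᵇ : ∀ {n} → ℕ → ℕ → Subset n → Bool
avoidsᵇ {n} l m X = not (does (nonempty? (X ∩ interval n l m)))

∑-coprime-avoiding : ∀ {n} l m .{{_ : NonZero n}} (K : Subset n → Bool) →
  ∑[ X ∈ allSubsets n ] 𝟙 (K X ∧ (avoidsᵇ l m X ∧ does (gcdWithN n X ≟ 1)))
    ≡ ∑∣≤ n n (λ d → μ d * (∑[ X ∈ allSubsets n ] 𝟙 (K X ∧ does (X ⊆? admissible n l m d))))
∑-coprime-avoiding {n} l m K = begin
  ∑[ X ∈ S ] 𝟙 (K X ∧ (E X ∧ G X))                       ≡⟨ ∑-cong S expand ⟩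
  ∑[ X ∈ S ] ∑< n (term X)                               ≡⟨ ∑-∑<-comm S n term ⟩
  ∑[ j < n ] ∑[ X ∈ S ] term X j                         ≡⟨ ∑<-cong n (λ j _ → collect j) ⟩
  ∑∣≤ n n (λ d → μ d * (∑[ X ∈ S ] 𝟙 (K X ∧ does (X ⊆? admissible n l m d))))  ∎
  where
  open ≡-Reasoning
  S : List (Subset n)
  S = allSubsets n
  E G : Subset n → Bool
  E X = avoidsᵇ l m X
  G X = does (gcdWithN n X ≟ 1)
  D : ℕ → Subset n → Bool
  D d X = does (d ∣? gcdWithN n X)
  term : Subset n → ℕ → ℤ
  term X j = 𝟙 (K X) * (𝟙 (E X) * (𝟙 (D (suc j) X) * μ (suc j)))
  expand : ∀ X → 𝟙 (K X ∧ (E X ∧ G X)) ≡ ∑< n (term X)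
  expand X = begin
    𝟙 (K X ∧ (E X ∧ G X))                                      ≡⟨ trans (𝟙-∧ (K X) _) (cong (𝟙 (K X) *_) (𝟙-∧ (E X) (G X))) ⟩
    𝟙 (K X) * (𝟙 (E X) * 𝟙 (G X))                              ≡⟨ cong (λ y → 𝟙 (K X) * (𝟙 (E X) * y)) (𝟙-gcd≡1 n X) ⟩
    𝟙 (K X) * (𝟙 (E X) * ∑∣≤ n (gcdWithN n X) μ)               ≡⟨ cong (𝟙 (K X) *_) (∑<-*ˡ n (𝟙 (E X)) _) ⟨
    𝟙 (K X) * (∑[ j < n ] (𝟙 (E X) * (𝟙 (D (suc j) X) * μ (suc j))))  ≡⟨ ∑<-*ˡ n (𝟙 (K X)) _ ⟨
    ∑< n (term X)                                              ∎
  collect : ∀ j → ∑[ X ∈ S ] term X j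
                  ≡ 𝟙 (does (suc j ∣? n)) * (μ (suc j) * (∑[ X ∈ S ] 𝟙 (K X ∧ does (X ⊆? admissible n l m (suc j)))))
  collect j = begin
    ∑[ X ∈ S ] term X j                                            ≡⟨ ∑-cong S regroup ⟩
    ∑[ X ∈ S ] (c * (μ d * 𝟙 (K X ∧ a X)))                         ≡⟨ ∑-*ˡ S c _ ⟩
    c * (∑[ X ∈ S ] (μ d * 𝟙 (K X ∧ a X)))                         ≡⟨ cong (c *_) (∑-*ˡ S (μ d) _) ⟩
    c * (μ d * (∑[ X ∈ S ] 𝟙 (K X ∧ a X)))                         ∎
    where
    d : ℕ
    d = suc j
    c : ℤ
    c = 𝟙 (does (d ∣? n))
    a : Subset n → Bool
    a X = does (X ⊆? admissible n l m d)
    regroup : ∀ X → term X j ≡ c * (μ d * 𝟙 (K X ∧ a X))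
    regroup X = 𝟙-regroup (K X) (E X) (D d X) (does (d ∣? n)) (a X) (μ d)
      (does-⇔ (avoids∧∣gcd⇔∣∧⊆admissible l m d X)
              (¬? (nonempty? (X ∩ interval n l m)) ×-dec (d ∣? gcdWithN n X))
              ((d ∣? n) ×-dec (X ⊆? admissible n l m d)))

ε≡∑μ2^ : ∀ {l m n} → 1 < n → l ≤ m → m ≤ n → + ε l m n ≡ sumDivisors n (summandA l m n)
ε≡∑μ2^ {l} {m} {n} 1<n l≤m m≤n = begin
  + ε l m n                                                                ≡⟨ length-filter _ S ⟩
  ∑[ X ∈ S ] 𝟙 (does (nonempty? X) ∧ (avoidsᵇ l m X ∧ does (gcdWithN n X ≟ 1)))
                                                                           ≡⟨ ∑-cong S drop-nonempty ⟩
  ∑[ X ∈ S ] 𝟙 (avoidsᵇ l m X ∧ does (gcdWithN n X ≟ 1))                   ≡⟨ ∑-coprime-avoiding {n} l m (λ _ → true) ⟩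
  ∑∣≤ n n F                                                                ≡⟨ ∑∣≤-cong n n {F} {summandA l m n} count ⟩
  ∑∣≤ n n (summandA l m n)                                                 ≡⟨ sumDivisors≡∑∣≤ n (summandA l m n) ⟨
  sumDivisors n (summandA l m n)                                           ∎
  where
  open ≡-Reasoning
  instance
    n≢0 : NonZero n
    n≢0 = ℕ.>-nonZero (ℕ.<-trans z<s 1<n)
  S : List (Subset n)
  S = allSubsets n
  drop-nonempty : ∀ X → 𝟙 (does (nonempty? X) ∧ (avoidsᵇ l m X ∧ does (gcdWithN n X ≟ 1)))
                      ≡ 𝟙 (avoidsᵇ l m X ∧ does (gcdWithN n X ≟ 1))
  drop-nonempty X = cong 𝟙 (does-⇔ (mk⇔ proj₂ (λ (X∩I≡∅ , g≡1) → gcdWithN≡1⇒nonempty 1<n X g≡1 , X∩I≡∅ , g≡1))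
    (nonempty? X ×-dec (¬? (nonempty? (X ∩ interval n l m)) ×-dec (gcdWithN n X ≟ 1)))
    (¬? (nonempty? (X ∩ interval n l m)) ×-dec (gcdWithN n X ≟ 1)))
  F : ℕ → ℤ
  F d = μ d * (∑[ X ∈ S ] 𝟙 (does (X ⊆? admissible n l m d)))
  count : ∀ d′ → F (suc d′) ≡ summandA l m n (suc d′)
  count d′ = cong (μ (suc d′) *_) (trans (#subsets-⊆ (admissible n l m (suc d′)))
                                        (cong (λ e → + (2 ^ e)) (∣admissible∣≡expo d′ l≤m m≤n)))

εₖ≡∑μC : ∀ {l m n} k → .{{NonZero n}} → l ≤ m → m ≤ n → + εₖ k l m n ≡ sumDivisors n (summandB k l m n)
εₖ≡∑μC {l} {m} {n} k l≤m m≤n = begin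
  + εₖ k l m n                                                             ≡⟨ length-filter _ S ⟩
  ∑[ X ∈ S ] 𝟙 (does (Subset.∣ X ∣ ≟ k) ∧ (avoidsᵇ l m X ∧ does (gcdWithN n X ≟ 1)))
                                                                           ≡⟨ ∑-coprime-avoiding {n} l m (λ X → does (Subset.∣ X ∣ ≟ k)) ⟩
  ∑∣≤ n n F                                                                ≡⟨ ∑∣≤-cong n n {F} {summandB k l m n} count ⟩
  ∑∣≤ n n (summandB k l m n)                                               ≡⟨ sumDivisors≡∑∣≤ n (summandB k l m n) ⟨
  sumDivisors n (summandB k l m n)                                         ∎
  where
  open ≡-Reasoning
  S : List (Subset n)
  S = allSubsets n
  F : ℕ → ℤ
  F d = μ d * (∑[ X ∈ S ] 𝟙 (does (Subset.∣ X ∣ ≟ k) ∧ does (X ⊆? admissible n l m d)))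
  count : ∀ d′ → F (suc d′) ≡ summandB k l m n (suc d′)
  count d′ = cong (μ (suc d′) *_) (trans (#subsets-⊆-of-size (admissible n l m (suc d′)) k)
                                        (cong (λ e → + (e C k)) (∣admissible∣≡expo d′ l≤m m≤n)))

theorem3 : (l m n k : ℕ) → 1 ≤ l → 1 ≤ k → l ≤ m → m < n →
  (+ ε l m n ≡ sumDivisors n (summandA l m n))
    × (+ εₖ k l m n ≡ sumDivisors n (summandB k l m n))
theorem3 l m n k 1≤l _ l≤m m<n = ε≡∑μ2^ 1<n l≤m m≤n , εₖ≡∑μC k {{ℕ.>-nonZero (ℕ.<-trans z<s 1<n)}} l≤m m≤n
  where
  m≤n : m ≤ n
  m≤n = ℕ.<⇒≤ m<n
  1<n : 1 < n
  1<n = ℕ.≤-<-trans (ℕ.≤-trans 1≤l l≤m) m<n
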